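{- Let $v$ be a $321$-avoiding and $2$-repeating permutation. Then there exists an admissible configuration of points $\mathcal{C}$ such that $\underline{v_{\mathcal{C}}}$ is a reduced expression of $v$.
   Context: Symmetric groups have Coxeter generators $s_i=(i,i+1)$. A permutation is $321$-avoiding if no reduced expression of it contains a subword of consecutive letters of the form $s_is_{i\pm1}s_i$; for such $v$ the number $n_v(i)$ of occurrences of $s_i$ in a reduced expression is independent of the expression, and $v$ is $2$-repeating if $n_v(i)\le2$ for all $i$. Let $\mathcal{T}=\{(i,j)\in\mathbb{Z}^2 : j\le 0,\ |i|\le|j|,\ i\equiv j\bmod 2\}$; a configuration of points is a finite subset of $\mathcal{T}$. It is admissible if: (a) no three points share a $y$-coordinate; (b) two distinct points with the same $y$-coordinate have $x$-coordinates differing by exactly $2$; (c) if $(i_1,j_1),(i_2,j_2)\in\mathcal{C}$ with $j_1=j_2$ and $i_1<i_2$, then $(i_1+1,j_1\pm1)\in\mathcal{C}$. The point $(i,j)$ carries the letter $s_{1-j}$, and $\underline{v_{\mathcal{C}}}$ is the word obtained by reading the points of $\mathcal{C}$ from left to right and from top to bottom. -}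

module Defs where

open import Data.Nat as ℕ using (ℕ; zero; suc; _≤_; _<_)
open import Data.Nat.Properties using (_≟_)
open import Data.Integer as ℤ using (ℤ; +_; ∣_∣; _-_)
open import Data.Integer.Divisibility using () renaming (_∣_ to _∣ℤ_)
open import Data.Fin using (Fin; toℕ)
open import Data.Fin.Permutation using (Permutation′; _⟨$⟩ʳ_)
open import Data.List using (List; []; _∷_; _++_; map; length; filter)
open import Data.List.Relation.Unary.All using (All)
open import Data.List.Relation.Unary.Linked using (Linked)
open import Data.List.Membership.Propositional using (_∈_)
open import Data.Product using (_×_; _,_; proj₁; proj₂; ∃-syntax)
open import Data.Sum using (_⊎_)
open import Data.Empty using (⊥)
open import Relation.Nullary using (¬_; yes; no)
open import Relation.Binary.PropositionalEquality using (_≡_; _≢_)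

-- A word is a list of indices; the letter k stands for s_k = (k, k+1).
Word : Set
Word = List ℕ

ValidWord : ℕ → Word → Set
ValidWord n w = All (λ k → 1 ≤ k × k < n) w

swap : ℕ → ℕ → ℕ
swap k m with m ≟ k
... | yes _ = suc k
... | no _ with m ≟ suc k
...   | yes _ = k
...   | no _ = m

-- The product s_{a1} s_{a2} ... s_{ar} as a map (composition of functions,
-- rightmost letter applied first).
evalWord : Word → ℕ → ℕ
evalWord [] m = m
evalWord (k ∷ w) m = swap k (evalWord w m)

-- The word w represents v ∈ S_n (S_n acting on {1,…,n}, Fin n ≅ {1,…,n} via i ↦ i+1).
Represents : (n : ℕ) → Word → Permutation′ n → Set
Represents n w v = ∀ (i : Fin n) → evalWord w (suc (toℕ i)) ≡ suc (toℕ (v ⟨$⟩ʳ i))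

ReducedExpr : (n : ℕ) → Permutation′ n → Word → Set
ReducedExpr n v w =
  ValidWord n w × Represents n w v ×
  (∀ (w′ : Word) → ValidWord n w′ → Represents n w′ v → length w ≤ length w′)

HasBraidFactor : Word → Set
HasBraidFactor w =
  ∃[ xs ] ∃[ ys ] ∃[ i ] ∃[ j ] ((j ≡ suc i ⊎ i ≡ suc j) × w ≡ xs ++ (i ∷ j ∷ i ∷ ys))

-- 321-avoiding (as defined in the paper): no reduced expression has a factor s_i s_{i±1} s_i.
Avoids321 : (n : ℕ) → Permutation′ n → Set
Avoids321 n v = ∀ (w : Word) → ReducedExpr n v w → ¬ HasBraidFactor w

occ : ℕ → Word → ℕ
occ i w = length (filter (_≟ i) w)

TwoRepeating : (n : ℕ) → Permutation′ n → Set
TwoRepeating n v = ∀ (w : Word) → ReducedExpr n v w → ∀ (i : ℕ) → occ i w ≤ 2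

Point : Set
Point = ℤ × ℤ

xc : Point → ℤ
xc = proj₁

yc : Point → ℤ
yc = proj₂

InT : Point → Set
InT (i , j) = (j ℤ.≤ + 0) × (∣ i ∣ ≤ ∣ j ∣) × ((+ 2) ∣ℤ (i - j))

_<read_ : Point → Point → Set
(i₁ , j₁) <read (i₂ , j₂) = (i₁ ℤ.< i₂) ⊎ ((i₁ ≡ i₂) × (j₂ ℤ.< j₁))

-- A configuration of points (a finite subset of 𝒯) is represented by the list of its
-- elements listed strictly increasingly in the reading order (canonical listing of a
-- finite set; strictness gives distinctness).
IsConfiguration : List Point → Set
IsConfiguration C = All InT C × Linked _<read_ C

-- the letter carried by (i,j) is s_{1-j}; since j ≤ 0, 1 - j = 1 + |j|
letter : Point → ℕ
letter (i , j) = suc ∣ j ∣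

readingWord : List Point → Word
readingWord C = map letter C

Admissible : List Point → Set
Admissible C =
  (∀ p q r → p ∈ C → q ∈ C → r ∈ C → p ≢ q → q ≢ r → p ≢ r →
     yc p ≡ yc q → yc q ≡ yc r → ⊥)
  ×
  (∀ p q → p ∈ C → q ∈ C → p ≢ q → yc p ≡ yc q →
     ∣ xc p - xc q ∣ ≡ 2)
  ×
  (∀ p q → p ∈ C → q ∈ C → yc p ≡ yc q → xc p ℤ.< xc q →
     ((xc p ℤ.+ + 1 , yc p ℤ.+ + 1) ∈ C) × ((xc p ℤ.+ + 1 , yc p - + 1) ∈ C))

-- In a reduced word of a 321-avoiding permutation, between two occurrences of s_k there
-- are occurrences of both neighbours s_{k±1}: otherwise commuting s_k towards its next
-- occurrence produces s_k s_k or a braid s_k s_{k±1} s_k. So the occurrences of s_k and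
-- s_{k+1} alternate, and the c-th occurrence of s_{m+1} can be put in row m of the
-- triangle, at a column that moves right by one at each alternation. Reading the points
-- left to right and top to bottom then only reorders commuting letters, so it is again a
-- reduced expression, and at most two occurrences per letter make the configuration
-- admissible.

module Submission where

open import Defs
open import Data.Nat using (ℕ; zero; suc; _+_; _*_; _∸_; _≤_; _<_; z≤n; s≤s; z<s; _≟_; _<?_; _≤?_)
open import Data.Nat.Properties
open import Data.Nat.Induction using (<-wellFounded)
open import Data.Nat.Divisibility using (m∣m*n)
open import Data.Integer as ℤ using (ℤ; +_; -_; ∣_∣)
import Data.Integer.Properties as ℤP
open import Data.Integer.Divisibility using () renaming (_∣_ to _∣ℤ_)
open import Data.Integer.Tactic.RingSolver using (solve-∀)
open import Data.Fin using (Fin; toℕ; fromℕ<)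
open import Data.Fin.Properties using (toℕ<n; fromℕ<-toℕ; toℕ-fromℕ<; toℕ-injective) renaming (all? to allFin?)
open import Data.Fin.Permutation using (Permutation′; _⟨$⟩ʳ_; _⟨$⟩ˡ_; inverseˡ)
open import Data.List using (List; []; _∷_; _++_; [_]; _∷ʳ_; length; reverse; filter)
open import Data.List.Properties using (length-++; length-++-≤ˡ; length-++-≤ʳ; ++-assoc; ++-identityʳ;
  reverse-involutive; reverse-++; unfold-reverse; filter-++; filter-accept; filter-reject)
open import Data.List.Membership.Propositional using (_∈_)
open import Data.List.Relation.Unary.All as All using (All; []; _∷_)
import Data.List.Relation.Unary.All.Properties as All
open import Data.List.Relation.Unary.AllPairs using (AllPairs; []; _∷_)
open import Data.List.Relation.Unary.Any using (here; there)
import Data.List.Relation.Unary.First as First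
open import Data.List.Relation.Unary.First.Properties using (toView)
open import Data.List.Relation.Unary.Linked.Properties using (AllPairs⇒Linked)
open import Data.List.Relation.Binary.Permutation.Propositional as ↭ using (_↭_; ↭-refl; ↭-sym; ↭-trans; prep)
open import Data.List.Relation.Binary.Permutation.Propositional.Properties
  using (All-resp-↭; ∈-resp-↭; ↭-length; ↭-reverse; ++⁺ˡ; ++⁺ʳ)
open import Data.Product as Product using (_×_; _,_; proj₁; proj₂; ∃-syntax; Σ-syntax)
open import Data.Product.Relation.Binary.Lex.Strict using (×-isStrictTotalOrder)
open import Data.Product.Relation.Binary.Pointwise.NonDependent using (Pointwise; ≡⇒≡×≡; ≡×≡⇒≡)
open import Data.Sum as Sum using (_⊎_; inj₁; inj₂)
open import Data.Empty using (⊥; ⊥-elim)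
open import Function using (_∘_)
open import Induction.WellFounded using (Acc; acc)
open import Relation.Nullary using (¬_; Dec; yes; no)
open import Relation.Nullary.Decidable using (_⊎-dec_; _×-dec_; map′; toSum)
open import Level using (0ℓ)
open import Relation.Binary.Bundles using (Setoid)
open import Relation.Binary.Definitions using (tri<; tri≈; tri>)
open import Relation.Binary.Structures using (IsStrictTotalOrder)
import Relation.Binary.Construct.Flip.EqAndOrd as Flip
open import Relation.Binary.PropositionalEquality
  using (_≡_; _≢_; refl; sym; trans; cong; cong₂; subst; subst₂; module ≡-Reasoning)
import Relation.Binary.Reasoning.Setoid as SetoidReasoning

Near : ℕ → ℕ → Set
Near k m = m ≡ k ⊎ m ≡ suc k

near? : ∀ k m → Dec (Near k m)
near? k m = (m ≟ k) ⊎-dec (m ≟ suc k)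

Near⇒bounds : ∀ {k m} → Near k m → k ≤ m × m ≤ suc k
Near⇒bounds {k} (inj₁ refl) = ≤-refl , n≤1+n k
Near⇒bounds {k} (inj₂ refl) = n≤1+n k , ≤-refl

swap-far : ∀ {k m} → ¬ Near k m → swap k m ≡ m
swap-far {k} {m} far with m ≟ k
... | yes m≡k = ⊥-elim (far (inj₁ m≡k))
... | no _ with m ≟ suc k
...   | yes m≡1+k = ⊥-elim (far (inj₂ m≡1+k))
...   | no _ = refl

swap-lower : ∀ k → swap k k ≡ suc k
swap-lower k with k ≟ k
... | yes _ = refl
... | no k≢k = ⊥-elim (k≢k refl)

swap-upper : ∀ k → swap k (suc k) ≡ k
swap-upper k with suc k ≟ k
... | yes 1+k≡k = ⊥-elim (1+n≢n 1+k≡k)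
... | no _ with suc k ≟ suc k
...   | yes _ = refl
...   | no 1+k≢1+k = ⊥-elim (1+k≢1+k refl)

swap-near : ∀ {k m} → Near k m → Near k (swap k m)
swap-near {k} (inj₁ refl) = inj₂ (swap-lower k)
swap-near {k} (inj₂ refl) = inj₁ (swap-upper k)

swap-involutive : ∀ k m → swap k (swap k m) ≡ m
swap-involutive k m with near? k m
... | yes (inj₁ refl) = trans (cong (swap k) (swap-lower k)) (swap-upper k)
... | yes (inj₂ refl) = trans (cong (swap k) (swap-upper k)) (swap-lower k)
... | no far = trans (cong (swap k) (swap-far far)) (swap-far far)

Distant : ℕ → ℕ → Set
Distant a b = suc a < b ⊎ suc b < a

distant? : ∀ a b → Dec (Distant a b)
distant? a b = (suc a <? b) ⊎-dec (suc b <? a)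

Distant-sym : ∀ {a b} → Distant a b → Distant b a
Distant-sym = Sum.swap

Distant⇒≢ : ∀ {a b} → Distant a b → b ≢ a
Distant⇒≢ {a} (inj₁ 1+a<a) refl = <-asym (n<1+n a) 1+a<a
Distant⇒≢ {a} (inj₂ 1+a<a) refl = <-asym (n<1+n a) 1+a<a

Distant-irrefl : ∀ {a} → ¬ Distant a a
Distant-irrefl d = Distant⇒≢ d refl

Distant⇒¬Near : ∀ {a b m} → Distant a b → Near a m → ¬ Near b m
Distant⇒¬Near (inj₁ 1+a<b) near-a near-b =
  <-irrefl refl (<-≤-trans 1+a<b (≤-trans (proj₁ (Near⇒bounds near-b)) (proj₂ (Near⇒bounds near-a))))
Distant⇒¬Near (inj₂ 1+b<a) near-a near-b =
  <-irrefl refl (<-≤-trans 1+b<a (≤-trans (proj₁ (Near⇒bounds near-a)) (proj₂ (Near⇒bounds near-b))))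

swap-comm : ∀ {a b} → Distant a b → ∀ m → swap a (swap b m) ≡ swap b (swap a m)
swap-comm {a} {b} d m with near? a m | near? b m
... | yes near-a | _ =
  trans (cong (swap a) (swap-far (Distant⇒¬Near d near-a)))
        (sym (swap-far (Distant⇒¬Near d (swap-near near-a))))
... | no far-a | yes near-b =
  trans (swap-far (Distant⇒¬Near (Distant-sym d) (swap-near near-b)))
        (cong (swap b) (sym (swap-far far-a)))
... | no far-a | no far-b =
  trans (cong (swap a) (swap-far far-b))
        (trans (swap-far far-a) (sym (trans (cong (swap b) (swap-far far-a)) (swap-far far-b))))

evalWord-++ : ∀ u w m → evalWord (u ++ w) m ≡ evalWord u (evalWord w m)
evalWord-++ [] w m = refl
evalWord-++ (k ∷ u) w m = cong (swap k) (evalWord-++ u w m)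

-- Coarser than commutation equivalence, but it keeps exactly what transfers
-- reduced expressions: the multiset of letters and the product.
infix 4 _∼_
_∼_ : Word → Word → Set
u ∼ w = (u ↭ w) × (∀ m → evalWord u m ≡ evalWord w m)

∼-refl : ∀ {w} → w ∼ w
∼-refl = ↭-refl , λ _ → refl

∼-sym : ∀ {u w} → u ∼ w → w ∼ u
∼-sym (p , e) = ↭-sym p , λ m → sym (e m)

∼-trans : ∀ {u w x} → u ∼ w → w ∼ x → u ∼ x
∼-trans (p , e) (q , f) = ↭-trans p q , λ m → trans (e m) (f m)

∼-setoid : Setoid 0ℓ 0ℓ
∼-setoid = record
  { Carrier = Word ; _≈_ = _∼_
  ; isEquivalence = record { refl = ∼-refl ; sym = ∼-sym ; trans = ∼-trans } }

module ∼-Reasoning = SetoidReasoning ∼-setoid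

∼-++ˡ : ∀ xs {u w} → u ∼ w → xs ++ u ∼ xs ++ w
∼-++ˡ xs {u} {w} (p , e) = ++⁺ˡ xs p , λ m → begin
  evalWord (xs ++ u) m       ≡⟨ evalWord-++ xs u m ⟩
  evalWord xs (evalWord u m) ≡⟨ cong (evalWord xs) (e m) ⟩
  evalWord xs (evalWord w m) ≡⟨ evalWord-++ xs w m ⟨
  evalWord (xs ++ w) m       ∎
  where open ≡-Reasoning

∼-++ʳ : ∀ ys {u w} → u ∼ w → u ++ ys ∼ w ++ ys
∼-++ʳ ys {u} {w} (p , e) = ++⁺ʳ ys p , λ m → begin
  evalWord (u ++ ys) m        ≡⟨ evalWord-++ u ys m ⟩
  evalWord u (evalWord ys m)  ≡⟨ e (evalWord ys m) ⟩
  evalWord w (evalWord ys m)  ≡⟨ evalWord-++ w ys m ⟨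
  evalWord (w ++ ys) m        ∎
  where open ≡-Reasoning

∼-swap : ∀ {a b} ys → Distant a b → a ∷ b ∷ ys ∼ b ∷ a ∷ ys
∼-swap {a} {b} ys d = ↭.swap a b ↭-refl , λ m → swap-comm d (evalWord ys m)

commute-past : ∀ {a} m ys → All (Distant a) m → m ++ a ∷ ys ∼ a ∷ m ++ ys
commute-past [] ys [] = ∼-refl
commute-past (b ∷ m) ys (d ∷ ds) =
  ∼-trans (∼-++ˡ [ b ] (commute-past m ys ds)) (∼-swap (m ++ ys) (Distant-sym d))

ReducedExpr-resp-∼ : ∀ {n v u w} → u ∼ w → ReducedExpr n v u → ReducedExpr n v w
ReducedExpr-resp-∼ (p , e) (valid , represents , shortest) =
  All-resp-↭ p valid ,
  (λ i → trans (sym (e _)) (represents i)) ,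
  (λ w′ valid′ represents′ → subst (_≤ length w′) (↭-length p) (shortest w′ valid′ represents′))

reduced-no-square : ∀ {n v} xs a ys → ¬ ReducedExpr n v (xs ++ a ∷ a ∷ ys)
reduced-no-square {n} {v} xs a ys (valid , represents , shortest) =
  <-irrefl refl (<-≤-trans longer (shortest (xs ++ ys) valid′ represents′))
  where
    valid′ : ValidWord n (xs ++ ys)
    valid′ = All.++⁺ (All.++⁻ˡ xs valid) (All.tail (All.tail (All.++⁻ʳ xs valid)))
    cancel : ∀ m → evalWord (xs ++ a ∷ a ∷ ys) m ≡ evalWord (xs ++ ys) m
    cancel m = begin
      evalWord (xs ++ a ∷ a ∷ ys) m                 ≡⟨ evalWord-++ xs (a ∷ a ∷ ys) m ⟩
      evalWord xs (swap a (swap a (evalWord ys m))) ≡⟨ cong (evalWord xs) (swap-involutive a _) ⟩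
      evalWord xs (evalWord ys m)                   ≡⟨ evalWord-++ xs ys m ⟨
      evalWord (xs ++ ys) m                         ∎
      where open ≡-Reasoning
    represents′ : Represents n (xs ++ ys) v
    represents′ i = trans (sym (cancel _)) (represents i)
    longer : length (xs ++ ys) < length (xs ++ a ∷ a ∷ ys)
    longer rewrite length-++ xs {ys} | length-++ xs {a ∷ a ∷ ys} =
      +-monoʳ-< (length xs) (<-trans (n<1+n _) (n<1+n _))

module _ {P : ℕ → Set} (P? : ∀ n → Dec (P n)) where

  least-witness : ∀ {k} → P k → ∃[ m ] (P m × ∀ {m′} → m′ < m → ¬ P m′)
  least-witness {k} = go k ≤-refl
    where
    go : ∀ bound {m} → m ≤ bound → P m → ∃[ m ] (P m × ∀ {m′} → m′ < m → ¬ P m′)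
    go bound {m} m≤bound pm with anyUpTo? P? m
    ... | no nothing-below = m , pm , λ m′<m pm′ → nothing-below (_ , m′<m , pm′)
    go (suc bound) m≤bound pm | yes (m′ , m′<m , pm′) = go bound (≤-pred (<-≤-trans m′<m m≤bound)) pm′
    go zero z≤n pm | yes (_ , () , _)

word-of-length? : ∀ {Q : Word → Set} bound → (∀ w → Dec (Q w)) → ∀ L →
  Dec (∃[ w ] (length w ≡ L × All (_< bound) w × Q w))
word-of-length? bound Q? zero =
  map′ (λ q → [] , refl , [] , q) (λ { ([] , _ , _ , q) → q ; (_ ∷ _ , () , _) }) (Q? [])
word-of-length? bound Q? (suc L) =
  map′ (λ (a , a<bound , w , len , bounded , q) → a ∷ w , cong suc len , a<bound ∷ bounded , q)
       (λ { (a ∷ w , len , a<bound ∷ bounded , q) → a , a<bound , w , suc-injective len , bounded , q })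
       (anyUpTo? (λ a → word-of-length? bound (Q? ∘ (a ∷_)) L) bound)

shortest-word : ∀ {Q : Word → Set} bound → (∀ w → Dec (Q w)) → (∀ {w} → Q w → All (_< bound) w) →
  ∃[ w ] Q w → ∃[ w ] (Q w × ∀ w′ → Q w′ → length w ≤ length w′)
shortest-word bound Q? bounded (w₀ , q₀)
  with least-witness (word-of-length? bound Q?) (w₀ , refl , bounded q₀ , q₀)
... | _ , (w , refl , _ , q) , minimal =
  w , q , λ w′ q′ → ≮⇒≥ (λ w′<w → minimal w′<w (w′ , refl , bounded q′ , q′))

InRange : ℕ → ℕ → Set
InRange N m = 1 ≤ m × m ≤ N

swap-inRange : ∀ {N k m} → 1 ≤ k → k < N → InRange N m → InRange N (swap k m)
swap-inRange {k = k} {m} 1≤k k<N m∈N with near? k m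
... | yes (inj₁ refl) rewrite swap-lower k = s≤s z≤n , k<N
... | yes (inj₂ refl) rewrite swap-upper k = 1≤k , <⇒≤ k<N
... | no far rewrite swap-far far = m∈N

evalWord-inRange : ∀ {N} w → ValidWord N w → ∀ {m} → InRange N m → InRange N (evalWord w m)
evalWord-inRange [] [] m∈N = m∈N
evalWord-inRange (k ∷ w) ((1≤k , k<N) ∷ valid) m∈N = swap-inRange 1≤k k<N (evalWord-inRange w valid m∈N)

evalWord-fixes-above : ∀ {N} w → ValidWord N w → ∀ {m} → N < m → evalWord w m ≡ m
evalWord-fixes-above [] [] _ = refl
evalWord-fixes-above {N} (k ∷ w) ((_ , k<N) ∷ valid) {m} N<m
  rewrite evalWord-fixes-above w valid N<m = swap-far λ
    { (inj₁ refl) → <-asym k<N N<m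
    ; (inj₂ refl) → <-irrefl refl (≤-trans N<m k<N) }

evalWord-injective : ∀ w {a b} → evalWord w a ≡ evalWord w b → a ≡ b
evalWord-injective [] eq = eq
evalWord-injective (k ∷ w) {a} {b} eq = evalWord-injective w (begin
  evalWord w a                    ≡⟨ swap-involutive k _ ⟨
  swap k (swap k (evalWord w a))  ≡⟨ cong (swap k) eq ⟩
  swap k (swap k (evalWord w b))  ≡⟨ swap-involutive k _ ⟩
  evalWord w b                    ∎)
  where open ≡-Reasoning

evalWord-reverseʳ : ∀ w m → evalWord w (evalWord (reverse w) m) ≡ m
evalWord-reverseʳ [] m = refl
evalWord-reverseʳ (a ∷ w) m
  rewrite unfold-reverse a w | evalWord-++ (reverse w) [ a ] m | evalWord-reverseʳ w (swap a m) =
  swap-involutive a m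

evalWord-reverseˡ : ∀ w m → evalWord (reverse w) (evalWord w m) ≡ m
evalWord-reverseˡ w m =
  subst (λ u → evalWord (reverse w) (evalWord u m) ≡ m) (reverse-involutive w) (evalWord-reverseʳ (reverse w) m)

ascending : ℕ → ℕ → Word
ascending j zero = []
ascending j (suc d) = j ∷ ascending (suc j) d

ascending-top : ∀ j d → evalWord (ascending j d) (j + d) ≡ j
ascending-top j zero = +-identityʳ j
ascending-top j (suc d) rewrite +-suc j d | ascending-top (suc j) d = swap-upper j

ascending-valid : ∀ {N} j d → 1 ≤ j → j + d ≤ N → ValidWord N (ascending j d)
ascending-valid j zero 1≤j j+d≤N = []
ascending-valid {N} j (suc d) 1≤j j+d≤N rewrite +-suc j d =
  (1≤j , <-≤-trans (s≤s (m≤m+n j d)) j+d≤N) ∷ ascending-valid (suc j) d (s≤s z≤n) j+d≤N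

ascending-to : ∀ {N j} → InRange N j → ∃[ c ] (ValidWord N c × evalWord c N ≡ j)
ascending-to {N} {j} (1≤j , j≤N) =
  ascending j (N ∸ j) ,
  ascending-valid j (N ∸ j) 1≤j (≤-reflexive j+[N∸j]≡N) ,
  subst (λ m → evalWord (ascending j (N ∸ j)) m ≡ j) j+[N∸j]≡N (ascending-top j (N ∸ j))
  where
  j+[N∸j]≡N : j + (N ∸ j) ≡ N
  j+[N∸j]≡N = m+[n∸m]≡n j≤N

MapsInto : ℕ → (ℕ → ℕ) → Set
MapsInto N g = ∀ {m} → InRange N m → InRange N (g m)

InjectiveOn : ℕ → (ℕ → ℕ) → Set
InjectiveOn N g = ∀ {a b} → InRange N a → InRange N b → g a ≡ g b → a ≡ b

InRange-weaken : ∀ {N m} → InRange N m → InRange (suc N) m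
InRange-weaken (1≤m , m≤N) = 1≤m , m≤n⇒m≤1+n m≤N

ValidWord-weaken : ∀ {N w} → ValidWord N w → ValidWord (suc N) w
ValidWord-weaken = All.map (Product.map₂ m<n⇒m<1+n)

bijection-unwind : ∀ N g c → MapsInto (suc N) g → InjectiveOn (suc N) g →
  ValidWord (suc N) c → evalWord c (suc N) ≡ g (suc N) →
  MapsInto N (evalWord (reverse c) ∘ g) × InjectiveOn N (evalWord (reverse c) ∘ g)
bijection-unwind N g c maps injective valid c-top = maps′ , injective′
  where
  top : InRange (suc N) (suc N)
  top = s≤s z≤n , ≤-refl
  unwound-top : evalWord (reverse c) (g (suc N)) ≡ suc N
  unwound-top = subst (λ m → evalWord (reverse c) m ≡ suc N) c-top (evalWord-reverseˡ c (suc N))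
  injective′ : InjectiveOn N (evalWord (reverse c) ∘ g)
  injective′ a∈N b∈N eq = injective (InRange-weaken a∈N) (InRange-weaken b∈N) (evalWord-injective (reverse c) eq)
  maps′ : MapsInto N (evalWord (reverse c) ∘ g)
  maps′ {m} m∈N
    with evalWord-inRange (reverse c) (All-resp-↭ (↭-sym (↭-reverse c)) valid) (maps (InRange-weaken m∈N))
  ... | 1≤hm , hm≤1+N with m≤n⇒m<n∨m≡n hm≤1+N
  ...   | inj₁ hm<1+N = 1≤hm , ≤-pred hm<1+N
  ...   | inj₂ hm≡1+N = ⊥-elim (<-irrefl refl (subst (_≤ N) m≡1+N (proj₂ m∈N)))
    where
    m≡1+N : m ≡ suc N
    m≡1+N = injective (InRange-weaken m∈N) top (evalWord-injective (reverse c) (trans hm≡1+N (sym unwound-top)))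

-- Induction on N: a cycle s_j s_{j+1} ⋯ s_N carries N+1 to j = g (N+1), and what is
-- left to realise fixes N+1.
word-for-bijection : ∀ N g → MapsInto N g → InjectiveOn N g →
  ∃[ w ] (ValidWord N w × ∀ {m} → InRange N m → evalWord w m ≡ g m)
word-for-bijection zero g maps injective = [] , [] , λ (1≤m , m≤0) → ⊥-elim (<-irrefl refl (≤-trans 1≤m m≤0))
word-for-bijection (suc N) g maps injective = cycle ++ w , All.++⁺ cycle-valid (ValidWord-weaken valid) , correct
  where
  cycle : Word
  cycle = proj₁ (ascending-to (maps (s≤s z≤n , ≤-refl)))
  cycle-valid : ValidWord (suc N) cycle
  cycle-valid = proj₁ (proj₂ (ascending-to (maps (s≤s z≤n , ≤-refl))))
  cycle-top : evalWord cycle (suc N) ≡ g (suc N)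
  cycle-top = proj₂ (proj₂ (ascending-to (maps (s≤s z≤n , ≤-refl))))
  h : ℕ → ℕ
  h = evalWord (reverse cycle) ∘ g
  recursive : ∃[ w ] (ValidWord N w × ∀ {m} → InRange N m → evalWord w m ≡ h m)
  recursive = Product.uncurry (word-for-bijection N h) (bijection-unwind N g cycle maps injective cycle-valid cycle-top)
  w : Word
  w = proj₁ recursive
  valid : ValidWord N w
  valid = proj₁ (proj₂ recursive)
  correct : ∀ {m} → InRange (suc N) m → evalWord (cycle ++ w) m ≡ g m
  correct {m} (1≤m , m≤1+N) with m≤n⇒m<n∨m≡n m≤1+N
  ... | inj₁ m<1+N = begin
    evalWord (cycle ++ w) m       ≡⟨ evalWord-++ cycle w m ⟩
    evalWord cycle (evalWord w m) ≡⟨ cong (evalWord cycle) (proj₂ (proj₂ recursive) (1≤m , ≤-pred m<1+N)) ⟩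
    evalWord cycle (h m)          ≡⟨ evalWord-reverseʳ cycle (g m) ⟩
    g m                           ∎
    where open ≡-Reasoning
  ... | inj₂ refl = begin
    evalWord (cycle ++ w) (suc N)       ≡⟨ evalWord-++ cycle w (suc N) ⟩
    evalWord cycle (evalWord w (suc N)) ≡⟨ cong (evalWord cycle) (evalWord-fixes-above w valid ≤-refl) ⟩
    evalWord cycle (suc N)              ≡⟨ cycle-top ⟩
    g (suc N)                           ∎
    where open ≡-Reasoning

module _ {n : ℕ} (v : Permutation′ n) where

  -- v acting on ℕ, shifted to {1,…,n} and extended by the identity
  act : ℕ → ℕ
  act zero = zero
  act (suc i) with i <? n
  ... | yes i<n = suc (toℕ (v ⟨$⟩ʳ fromℕ< i<n))
  ... | no _ = suc i

  act-fin : ∀ i → act (suc (toℕ i)) ≡ suc (toℕ (v ⟨$⟩ʳ i))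
  act-fin i with toℕ i <? n
  ... | yes i<n = cong (λ j → suc (toℕ (v ⟨$⟩ʳ j))) (fromℕ<-toℕ i i<n)
  ... | no i≮n = ⊥-elim (i≮n (toℕ<n i))

  inRange-fin : ∀ {m} → InRange n m → Σ[ i ∈ Fin n ] m ≡ suc (toℕ i)
  inRange-fin {suc m} (_ , 1+m≤n) = fromℕ< 1+m≤n , cong suc (sym (toℕ-fromℕ< 1+m≤n))

  act-maps : MapsInto n act
  act-maps m∈n with inRange-fin m∈n
  ... | i , m≡1+i = subst (InRange n ∘ act) (sym m≡1+i)
                      (subst (InRange n) (sym (act-fin i)) (s≤s z≤n , toℕ<n (v ⟨$⟩ʳ i)))

  act-injective : InjectiveOn n act
  act-injective {a} {b} a∈n b∈n act-a≡act-b with inRange-fin a∈n | inRange-fin b∈n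
  ... | i , a≡1+i | j , b≡1+j = begin
    a                  ≡⟨ a≡1+i ⟩
    suc (toℕ i)        ≡⟨ cong (suc ∘ toℕ) i≡j ⟩
    suc (toℕ j)        ≡⟨ b≡1+j ⟨
    b                  ∎
    where
    open ≡-Reasoning
    images : suc (toℕ (v ⟨$⟩ʳ i)) ≡ suc (toℕ (v ⟨$⟩ʳ j))
    images = begin
      suc (toℕ (v ⟨$⟩ʳ i)) ≡⟨ act-fin i ⟨
      act (suc (toℕ i))    ≡⟨ cong act a≡1+i ⟨
      act a                ≡⟨ act-a≡act-b ⟩
      act b                ≡⟨ cong act b≡1+j ⟩
      act (suc (toℕ j))    ≡⟨ act-fin j ⟩
      suc (toℕ (v ⟨$⟩ʳ j)) ∎
    i≡j : i ≡ j
    i≡j = begin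
      i                  ≡⟨ inverseˡ v ⟨
      v ⟨$⟩ˡ (v ⟨$⟩ʳ i)   ≡⟨ cong (v ⟨$⟩ˡ_) (toℕ-injective (suc-injective images)) ⟩
      v ⟨$⟩ˡ (v ⟨$⟩ʳ j)   ≡⟨ inverseˡ v ⟩
      j                  ∎

  word-for-permutation : ∃[ w ] (ValidWord n w × Represents n w v)
  word-for-permutation with word-for-bijection n act act-maps act-injective
  ... | w , valid , correct = w , valid , λ i → trans (correct (s≤s z≤n , toℕ<n i)) (act-fin i)

  reduced-expression : ∃[ w ] ReducedExpr n v w
  reduced-expression with shortest-word n good? (All.map proj₂ ∘ proj₁) word-for-permutation
    where
    good? : ∀ w → Dec (ValidWord n w × Represents n w v)
    good? w = All.all? (λ k → (1 ≤? k) ×-dec (k <? n)) w ×-dec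
              allFin? (λ i → evalWord w (suc (toℕ i)) ≟ suc (toℕ (v ⟨$⟩ʳ i)))
  ... | w , (valid , represents) , shortest =
    w , valid , represents , λ w′ valid′ represents′ → shortest w′ (valid′ , represents′)

-- Reduced words of 321-avoiding permutations

Adjacent : ℕ → ℕ → Set
Adjacent a b = b ≡ suc a ⊎ a ≡ suc b

Adjacent-sym : ∀ {a b} → Adjacent a b → Adjacent b a
Adjacent-sym = Sum.swap

Adjacent⇒¬Distant : ∀ {a b} → Adjacent a b → ¬ Distant a b
Adjacent⇒¬Distant (inj₁ refl) (inj₁ 1+a<1+a) = <-irrefl refl 1+a<1+a
Adjacent⇒¬Distant {a} (inj₁ refl) (inj₂ 2+a<a) = <-asym (<-trans (n<1+n a) (n<1+n (suc a))) 2+a<a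
Adjacent⇒¬Distant {b = b} (inj₂ refl) (inj₁ 2+b<b) = <-asym (<-trans (n<1+n b) (n<1+n (suc b))) 2+b<b
Adjacent⇒¬Distant (inj₂ refl) (inj₂ 1+b<1+b) = <-irrefl refl 1+b<1+b

adjacent-if-not-distant : ∀ {a b} → b ≢ a → ¬ Distant a b → Adjacent a b
adjacent-if-not-distant {a} {b} b≢a close with <-cmp a b
... | tri≈ _ a≡b _ = ⊥-elim (b≢a (sym a≡b))
... | tri< a<b _ _ = Sum.[ (λ 1+a<b → ⊥-elim (close (inj₁ 1+a<b))) , inj₁ ∘ sym ] (m≤n⇒m<n∨m≡n a<b)
... | tri> _ _ b<a = Sum.[ (λ 1+b<a → ⊥-elim (close (inj₂ 1+b<a))) , inj₂ ∘ sym ] (m≤n⇒m<n∨m≡n b<a)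

adjacent-unique : ∀ {a b c c′} → Adjacent a b → Adjacent a c → Adjacent a c′ → c ≢ b → c′ ≢ b → c ≡ c′
adjacent-unique (inj₁ refl) (inj₁ refl) _ c≢b _ = ⊥-elim (c≢b refl)
adjacent-unique (inj₁ refl) (inj₂ refl) (inj₁ refl) _ c′≢b = ⊥-elim (c′≢b refl)
adjacent-unique (inj₁ refl) (inj₂ refl) (inj₂ 1+c≡1+c′) _ _ = suc-injective 1+c≡1+c′
adjacent-unique (inj₂ refl) (inj₁ refl) (inj₁ refl) _ _ = refl
adjacent-unique (inj₂ refl) (inj₁ refl) (inj₂ refl) _ c′≢b = ⊥-elim (c′≢b refl)
adjacent-unique (inj₂ refl) (inj₂ refl) _ c≢b _ = ⊥-elim (c≢b refl)

Avoiding : ℕ → ℕ → ℕ → Set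
Avoiding a b c = c ≢ a × c ≢ b

first-non-distant : ∀ a u → First.FirstView (Distant a) (¬_ ∘ Distant a) u ⊎ All (Distant a) u
first-non-distant a u = Sum.map₁ toView (First.first (toSum ∘ distant? a) u)

non-distant-neighbour : ∀ {a b c} m₁ m₂ → All (Avoiding a b) (m₁ ++ c ∷ m₂) → ¬ Distant a c →
  Adjacent a c × c ≢ b
non-distant-neighbour m₁ m₂ avoid close with All.++⁻ʳ m₁ avoid
... | (c≢a , c≢b) ∷ _ = adjacent-if-not-distant c≢a close , c≢b

Alternating : ℕ → Word → Set
Alternating k u = ∀ xs a mid ys → u ≡ xs ++ a ∷ mid ++ a ∷ ys → Near k a → All (¬_ ∘ Near k) mid → ⊥

module _ {n : ℕ} {v : Permutation′ n} (avoids : Avoids321 n v) where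

  -- Push s_a rightwards across the letters commuting with it: meeting s_a again
  -- contradicts reducedness, meeting the other neighbour c once yields a braid
  -- s_a s_c s_a, and meeting it twice leaves a shorter instance c ⋯ c avoiding a.
  neighbour-between-repeats : ∀ xs a mid ys {b} → Adjacent a b → All (Avoiding a b) mid →
    ¬ ReducedExpr n v (xs ++ a ∷ mid ++ a ∷ ys)
  neighbour-between-repeats xs a mid ys adj avoid = go xs a mid ys adj avoid (<-wellFounded (length mid))
    where
    go : ∀ xs a mid ys {b} → Adjacent a b → All (Avoiding a b) mid → Acc _<_ (length mid) →
      ¬ ReducedExpr n v (xs ++ a ∷ mid ++ a ∷ ys)
    go xs a mid ys adj avoid (acc shorter) red with first-non-distant a mid
    ... | inj₂ distant = reduced-no-square {n} {v} xs a (mid ++ ys)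
            (ReducedExpr-resp-∼ {n} {v} (∼-++ˡ xs (∼-++ˡ [ a ] (commute-past mid ys distant))) red)
    ... | inj₁ (First._++_∷_ {m₁} {c} distant₁ c-close m₂) with first-non-distant a m₂
    ...   | inj₂ distant₂ =
      avoids _ (ReducedExpr-resp-∼ {n} {v} to-braid red) (xs ++ m₁ , m₂ ++ ys , a , c , a-c , refl)
      where
      open ∼-Reasoning
      a-c : Adjacent a c
      a-c = proj₁ (non-distant-neighbour m₁ m₂ avoid c-close)
      to-braid : xs ++ a ∷ (m₁ ++ c ∷ m₂) ++ a ∷ ys ∼ (xs ++ m₁) ++ a ∷ c ∷ a ∷ m₂ ++ ys
      to-braid = begin
        xs ++ a ∷ (m₁ ++ c ∷ m₂) ++ a ∷ ys
          ≡⟨ cong (λ u → xs ++ a ∷ u) (++-assoc m₁ (c ∷ m₂) (a ∷ ys)) ⟩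
        xs ++ a ∷ m₁ ++ c ∷ m₂ ++ a ∷ ys
          ≈⟨ ∼-++ˡ xs (commute-past m₁ (c ∷ m₂ ++ a ∷ ys) distant₁) ⟨
        xs ++ m₁ ++ a ∷ c ∷ m₂ ++ a ∷ ys
          ≈⟨ ∼-++ˡ xs (∼-++ˡ m₁ (∼-++ˡ (a ∷ c ∷ []) (commute-past m₂ ys distant₂))) ⟩
        xs ++ m₁ ++ a ∷ c ∷ a ∷ m₂ ++ ys
          ≡⟨ ++-assoc xs m₁ _ ⟨
        (xs ++ m₁) ++ a ∷ c ∷ a ∷ m₂ ++ ys ∎
    ...   | inj₁ (First._++_∷_ {m₃} {c′} distant₃ c′-close m₄)
      with non-distant-neighbour m₁ m₂ avoid c-close
         | non-distant-neighbour m₃ m₄ (All.tail (All.++⁻ʳ m₁ avoid)) c′-close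
    ...     | a-c , c≢b | a-c′ , c′≢b with adjacent-unique adj a-c a-c′ c≢b c′≢b
    ...       | refl = go (xs ++ a ∷ m₁) c m₃ (m₄ ++ a ∷ ys) (Adjacent-sym a-c)
                         (All.map (λ a-d → (λ { refl → Adjacent⇒¬Distant a-c a-d }) , Distant⇒≢ a-d) distant₃)
                         (shorter (<-≤-trans (s≤s (length-++-≤ˡ m₃)) (length-++-≤ʳ (c ∷ m₃ ++ c ∷ m₄) {m₁})))
                         (subst (ReducedExpr n v) regroup red)
      where
      open ≡-Reasoning
      regroup : xs ++ a ∷ (m₁ ++ c ∷ m₃ ++ c ∷ m₄) ++ a ∷ ys ≡
                (xs ++ a ∷ m₁) ++ c ∷ m₃ ++ c ∷ m₄ ++ a ∷ ys
      regroup = begin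
        xs ++ a ∷ (m₁ ++ c ∷ m₃ ++ c ∷ m₄) ++ a ∷ ys
          ≡⟨ cong (λ u → xs ++ a ∷ u) (++-assoc m₁ _ (a ∷ ys)) ⟩
        xs ++ a ∷ m₁ ++ c ∷ (m₃ ++ c ∷ m₄) ++ a ∷ ys
          ≡⟨ cong (λ u → xs ++ a ∷ m₁ ++ c ∷ u) (++-assoc m₃ _ (a ∷ ys)) ⟩
        xs ++ a ∷ m₁ ++ c ∷ m₃ ++ c ∷ m₄ ++ a ∷ ys
          ≡⟨ ++-assoc xs (a ∷ m₁) _ ⟨
        (xs ++ a ∷ m₁) ++ c ∷ m₃ ++ c ∷ m₄ ++ a ∷ ys    ∎


  reduced-alternating : ∀ {w} → ReducedExpr n v w → ∀ k → Alternating k w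
  reduced-alternating red k xs a mid ys refl (inj₁ refl) far =
    neighbour-between-repeats xs k mid ys (inj₁ refl) (All.map (λ f → f ∘ inj₁ , f ∘ inj₂) far) red
  reduced-alternating red k xs a mid ys refl (inj₂ refl) far =
    neighbour-between-repeats xs (suc k) mid ys (inj₂ refl) (All.map (λ f → f ∘ inj₂ , f ∘ inj₁) far) red

Alternating-tail : ∀ {k x u} → Alternating k (x ∷ u) → Alternating k u
Alternating-tail alt xs a mid ys = alt (_ ∷ xs) a mid ys ∘ cong (_ ∷_)

Alternating-prefix : ∀ {k} P Q → Alternating k (P ++ Q) → Alternating k P
Alternating-prefix P Q alt xs a mid ys refl = alt xs a mid (ys ++ Q) (begin
  (xs ++ a ∷ mid ++ a ∷ ys) ++ Q  ≡⟨ ++-assoc xs _ Q ⟩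
  xs ++ a ∷ (mid ++ a ∷ ys) ++ Q  ≡⟨ cong (λ u → xs ++ a ∷ u) (++-assoc mid _ Q) ⟩
  xs ++ a ∷ mid ++ a ∷ ys ++ Q    ∎)
  where open ≡-Reasoning

occ-here : ∀ i u → occ i (i ∷ u) ≡ suc (occ i u)
occ-here i u = cong length (filter-accept (_≟ i) {i} {u} refl)

occ-there : ∀ {i x} u → x ≢ i → occ i (x ∷ u) ≡ occ i u
occ-there {i} {x} u x≢i = cong length (filter-reject (_≟ i) {x} {u} x≢i)

occ-++ : ∀ i P Q → occ i (P ++ Q) ≡ occ i P + occ i Q
occ-++ i P Q = trans (cong length (filter-++ (_≟ i) P Q)) (length-++ (filter (_≟ i) P))

occ-++-≤ˡ : ∀ i P R → occ i P ≤ occ i (P ++ R)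
occ-++-≤ˡ i P R = subst (occ i P ≤_) (sym (occ-++ i P R)) (m≤m+n _ _)

occ-++-≤ʳ : ∀ i P R → occ i R ≤ occ i (P ++ R)
occ-++-≤ʳ i P R = subst (occ i R ≤_) (sym (occ-++ i P R)) (m≤n+m _ _)

occ-reverse : ∀ i u → occ i (reverse u) ≡ occ i u
occ-reverse i [] = refl
occ-reverse i (x ∷ u) = begin
  occ i (reverse (x ∷ u))       ≡⟨ cong (occ i) (unfold-reverse x u) ⟩
  occ i (reverse u ++ [ x ])    ≡⟨ occ-++ i (reverse u) [ x ] ⟩
  occ i (reverse u) + occ i [ x ] ≡⟨ cong (_+ occ i [ x ]) (occ-reverse i u) ⟩
  occ i u + occ i [ x ]         ≡⟨ +-comm (occ i u) _ ⟩
  occ i [ x ] + occ i u         ≡⟨ occ-++ i [ x ] u ⟨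
  occ i (x ∷ u)                 ∎
  where open ≡-Reasoning

occ-absent : ∀ {i} u → All (_≢ i) u → occ i u ≡ 0
occ-absent [] [] = refl
occ-absent (x ∷ u) (x≢i ∷ rest) = trans (occ-there u x≢i) (occ-absent u rest)

occ-far : ∀ {k} u → All (¬_ ∘ Near k) u → occ k u ≡ 0 × occ (suc k) u ≡ 0
occ-far u far = occ-absent u (All.map (_∘ inj₁) far) , occ-absent u (All.map (_∘ inj₂) far)

occ-zero : ∀ u → All (1 ≤_) u → occ 0 u ≡ 0
occ-zero u positive = occ-absent u (All.map (λ { (s≤s z≤n) () }) positive)

lead : ℕ → Word → ℕ
lead k [] = 0
lead k (x ∷ u) with near? k x
... | yes (inj₁ _) = 1
... | yes (inj₂ _) = 0
... | no _ = lead k u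

lead-view : ∀ k u → All (¬_ ∘ Near k) u ⊎
  ∃[ mid ] ∃[ a ] ∃[ ys ] (u ≡ mid ++ a ∷ ys × All (¬_ ∘ Near k) mid ×
                          (a ≡ k × lead k u ≡ 1 ⊎ a ≡ suc k × lead k u ≡ 0))
lead-view k [] = inj₁ []
lead-view k (x ∷ u) with near? k x
... | yes (inj₁ x≡k) = inj₂ ([] , x , u , refl , [] , inj₁ (x≡k , refl))
... | yes (inj₂ x≡1+k) = inj₂ ([] , x , u , refl , [] , inj₂ (x≡1+k , refl))
... | no far with lead-view k u
...   | inj₁ all-far = inj₁ (far ∷ all-far)
...   | inj₂ (mid , a , ys , refl , mid-far , which) = inj₂ (x ∷ mid , a , ys , refl , far ∷ mid-far , which)

lead-++ : ∀ k P Q → All (¬_ ∘ Near k) P ⊎ lead k (P ++ Q) ≡ lead k P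
lead-++ k [] Q = inj₁ []
lead-++ k (x ∷ P) Q with near? k x
... | yes (inj₁ _) = inj₂ refl
... | yes (inj₂ _) = inj₂ refl
... | no far = Sum.map₁ (far ∷_) (lead-++ k P Q)

-- occ k P - occ (k+1) P ∈ {δ - 1, δ}, written without subtraction.
Balanced : ℕ → ℕ → Word → Set
Balanced k δ P = occ k P ≤ δ + occ (suc k) P × δ + occ (suc k) P ≤ suc (occ k P)

balanced-far : ∀ {k δ} P → δ ≤ 1 → All (¬_ ∘ Near k) P → Balanced k δ P
balanced-far {k} {δ} P δ≤1 far rewrite proj₁ (occ-far P far) | proj₂ (occ-far P far) | +-identityʳ δ = z≤n , δ≤1

lead≤1 : ∀ k u → lead k u ≤ 1
lead≤1 k [] = z≤n
lead≤1 k (x ∷ u) with near? k x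
... | yes (inj₁ _) = ≤-refl
... | yes (inj₂ _) = z≤n
... | no _ = lead≤1 k u

alternating-balanced : ∀ k u → Alternating k u → Balanced k (lead k u) u
alternating-balanced k [] alt = z≤n , z≤n
alternating-balanced k (x ∷ u) alt with near? k x
... | no far rewrite occ-there u (far ∘ inj₁) | occ-there u (far ∘ inj₂) = alternating-balanced k u (Alternating-tail alt)
... | yes (inj₁ refl) rewrite occ-here x u | occ-there {suc x} u (λ x≡1+x → 1+n≢n (sym x≡1+x)) =
  Product.map s≤s s≤s balanced-tail
  where
  balanced-tail : Balanced x 0 u
  balanced-tail with lead-view x u
  ... | inj₁ far = balanced-far u z≤n far
  ... | inj₂ (mid , a , ys , u≡ , mid-far , inj₁ (refl , _)) =
    ⊥-elim (alt [] x mid ys (cong (x ∷_) u≡) (inj₁ refl) mid-far)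
  ... | inj₂ (mid , a , ys , u≡ , mid-far , inj₂ (_ , lead≡0)) =
    subst (λ δ → Balanced x δ u) lead≡0 (alternating-balanced x u (Alternating-tail alt))
... | yes (inj₂ refl) rewrite occ-here (suc k) u | occ-there {k} u 1+n≢n = balanced-tail
  where
  balanced-tail : Balanced k 1 u
  balanced-tail with lead-view k u
  ... | inj₁ far = balanced-far u ≤-refl far
  ... | inj₂ (mid , a , ys , u≡ , mid-far , inj₂ (refl , _)) =
    ⊥-elim (alt [] (suc k) mid ys (cong (suc k ∷_) u≡) (inj₂ refl) mid-far)
  ... | inj₂ (mid , a , ys , u≡ , mid-far , inj₁ (_ , lead≡1)) =
    subst (λ δ → Balanced k δ u) lead≡1 (alternating-balanced k u (Alternating-tail alt))

prefix-balanced : ∀ k P Q → Alternating k (P ++ Q) → Balanced k (lead k (P ++ Q)) P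
prefix-balanced k P Q alt with lead-++ k P Q
... | inj₁ far = balanced-far P (lead≤1 k (P ++ Q)) far
... | inj₂ same rewrite same = alternating-balanced k P (Alternating-prefix P Q alt)

-- Column t of the row carrying the letter s_{m+1}.
spot : ℕ → ℕ → Point
spot m t = + (2 * t) ℤ.- + m , - + m

letter-spot : ∀ m t → letter (spot m t) ≡ suc m
letter-spot m t = cong suc (ℤP.∣-i∣≡∣i∣ (+ m))

row-injective : ∀ {m m′} → - + m ≡ - + m′ → m ≡ m′
row-injective = ℤP.+-injective ∘ ℤP.neg-injective

spot-inT : ∀ {m t} → t ≤ m → InT (spot m t)
spot-inT {m} {t} t≤m = ℤP.neg-mono-≤ (ℤ.+≤+ z≤n) , width , parity
  where
  -- with m = t + s, the point is t - s
  s : ℕ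
  s = m ∸ t
  centred : + (2 * t) ℤ.- + m ≡ + t ℤ.- + s
  centred = begin
    + (2 * t) ℤ.- + m              ≡⟨ cong (λ k → + (2 * t) ℤ.- + k) (m+[n∸m]≡n t≤m) ⟨
    + (2 * t) ℤ.- + (t + s)        ≡⟨ cong₂ ℤ._-_ (ℤP.pos-* 2 t) (ℤP.pos-+ t s) ⟩
    + 2 ℤ.* + t ℤ.- (+ t ℤ.+ + s)  ≡⟨ solve (+ t) (+ s) ⟩
    + t ℤ.- + s                    ∎
    where
    open ≡-Reasoning
    solve : ∀ (a b : ℤ) → + 2 ℤ.* a ℤ.- (a ℤ.+ b) ≡ a ℤ.- b
    solve = solve-∀
  width : ∣ + (2 * t) ℤ.- + m ∣ ≤ ∣ - + m ∣
  width rewrite centred | ℤP.∣-i∣≡∣i∣ (+ m) =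
    subst (∣ + t ℤ.- + s ∣ ≤_) (m+[n∸m]≡n t≤m) (ℤP.∣i-j∣≤∣i∣+∣j∣ (+ t) (+ s))
  parity : + 2 ∣ℤ (+ (2 * t) ℤ.- + m) ℤ.- (- + m)
  parity = subst (+ 2 ∣ℤ_) (sym (solve (+ (2 * t)) (+ m))) (m∣m*n t)
    where
    solve : ∀ (a b : ℤ) → (a ℤ.- b) ℤ.- (ℤ.- b) ≡ a
    solve = solve-∀

difference-< : ∀ a b c d → a + d < c + b → + a ℤ.- + b ℤ.< + c ℤ.- + d
difference-< a b c d a+d<c+b =
  subst₂ ℤ._<_ (solve (+ a) (+ b) (+ d)) (solve′ (+ c) (+ b) (+ d))
    (ℤP.+-monoˡ-< (ℤ.- (+ b ℤ.+ + d)) (subst₂ ℤ._<_ (ℤP.pos-+ a d) (ℤP.pos-+ c b) (ℤ.+<+ a+d<c+b)))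
  where
  solve : ∀ (x y z : ℤ) → (x ℤ.+ z) ℤ.+ ℤ.- (y ℤ.+ z) ≡ x ℤ.- y
  solve = solve-∀
  solve′ : ∀ (x y z : ℤ) → (x ℤ.+ y) ℤ.+ ℤ.- (y ℤ.+ z) ≡ x ℤ.- z
  solve′ = solve-∀

spot-left-same : ∀ {m t t′} → t < t′ → xc (spot m t) ℤ.< xc (spot m t′)
spot-left-same {m} t<t′ = difference-< _ m _ m (+-monoˡ-< m (*-monoʳ-< 2 t<t′))

spot-left-down : ∀ {m t t′} → t ≤ t′ → xc (spot (suc m) t) ℤ.< xc (spot m t′)
spot-left-down {m} {t} {t′} t≤t′ = difference-< _ (suc m) _ m
  (subst (2 * t + m <_) (sym (+-suc (2 * t′) m)) (s≤s (+-monoˡ-≤ m (*-monoʳ-≤ 2 t≤t′))))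

spot-left-up : ∀ {m t t′} → t < t′ → xc (spot m t) ℤ.< xc (spot (suc m) t′)
spot-left-up {m} {t} {t′} t<t′ = difference-< _ m _ (suc m) (begin-strict
  2 * t + suc m   ≡⟨ +-suc (2 * t) m ⟩
  suc (2 * t) + m <⟨ +-monoˡ-< m (subst (_≤ 2 * t′) (*-suc 2 t) (*-monoʳ-≤ 2 t<t′)) ⟩
  2 * t′ + m      ∎)
  where open ≤-Reasoning

spot-gap : ∀ m t → ∣ xc (spot m t) ℤ.- xc (spot m (suc t)) ∣ ≡ 2
spot-gap m t = cong ∣_∣ (begin
  (+ (2 * t) ℤ.- + m) ℤ.- (+ (2 * suc t) ℤ.- + m)
    ≡⟨ cong₂ (λ x y → (x ℤ.- + m) ℤ.- (y ℤ.- + m)) (ℤP.pos-* 2 t) (ℤP.pos-* 2 (suc t)) ⟩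
  (+ 2 ℤ.* + t ℤ.- + m) ℤ.- (+ 2 ℤ.* + suc t ℤ.- + m)
    ≡⟨ cong (λ x → (+ 2 ℤ.* + t ℤ.- + m) ℤ.- (+ 2 ℤ.* x ℤ.- + m)) (ℤP.pos-+ 1 t) ⟩
  (+ 2 ℤ.* + t ℤ.- + m) ℤ.- (+ 2 ℤ.* (+ 1 ℤ.+ + t) ℤ.- + m)
    ≡⟨ solve (+ t) (+ m) ⟩
  - + 2 ∎)
  where
  open ≡-Reasoning
  solve : ∀ (a b : ℤ) → (+ 2 ℤ.* a ℤ.- b) ℤ.- (+ 2 ℤ.* (+ 1 ℤ.+ a) ℤ.- b) ≡ - + 2
  solve = solve-∀

spot-up : ∀ m t → (xc (spot (suc m) t) ℤ.+ + 1 , yc (spot (suc m) t) ℤ.+ + 1) ≡ spot m t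
spot-up m t = cong₂ _,_
  (trans (cong (λ y → (+ (2 * t) ℤ.- y) ℤ.+ + 1) (ℤP.pos-+ 1 m)) (solve (+ (2 * t)) (+ m)))
  (trans (cong (λ y → ℤ.- y ℤ.+ + 1) (ℤP.pos-+ 1 m)) (solve′ (+ m)))
  where
  solve : ∀ (a b : ℤ) → (a ℤ.- (+ 1 ℤ.+ b)) ℤ.+ + 1 ≡ a ℤ.- b
  solve = solve-∀
  solve′ : ∀ (b : ℤ) → ℤ.- (+ 1 ℤ.+ b) ℤ.+ + 1 ≡ ℤ.- b
  solve′ = solve-∀

spot-down : ∀ m t → (xc (spot m t) ℤ.+ + 1 , yc (spot m t) ℤ.- + 1) ≡ spot (suc m) (suc t)
spot-down m t rewrite ℤP.pos-* 2 (suc t) | ℤP.pos-* 2 t | ℤP.pos-+ 1 t | ℤP.pos-+ 1 m =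
  cong₂ _,_ (solve (+ t) (+ m)) (solve′ (+ m))
  where
  solve : ∀ (a b : ℤ) → (+ 2 ℤ.* a ℤ.- b) ℤ.+ + 1 ≡ + 2 ℤ.* (+ 1 ℤ.+ a) ℤ.- (+ 1 ℤ.+ b)
  solve = solve-∀
  solve′ : ∀ (b : ℤ) → ℤ.- b ℤ.- + 1 ≡ ℤ.- (+ 1 ℤ.+ b)
  solve′ = solve-∀

<read-isStrictTotalOrder : IsStrictTotalOrder (Pointwise _≡_ _≡_) _<read_
<read-isStrictTotalOrder =
  ×-isStrictTotalOrder ℤP.<-isStrictTotalOrder (Flip.isStrictTotalOrder ℤP.<-isStrictTotalOrder)

open IsStrictTotalOrder <read-isStrictTotalOrder using (compare)
  renaming (_<?_ to _<read?_; trans to <read-trans; asym to <read-asym; irrefl to <read-irrefl′)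

<read-irrefl : ∀ {p} → ¬ p <read p
<read-irrefl = <read-irrefl′ (≡⇒≡×≡ refl)

insert : Point → List Point → List Point
insert p [] = [ p ]
insert p (q ∷ qs) with p <read? q
... | yes _ = p ∷ q ∷ qs
... | no _ = q ∷ insert p qs

sort : List Point → List Point
sort [] = []
sort (p ∷ ps) = insert p (sort ps)

insert-↭ : ∀ p qs → insert p qs ↭ p ∷ qs
insert-↭ p [] = ↭-refl
insert-↭ p (q ∷ qs) with p <read? q
... | yes _ = ↭-refl
... | no _ = ↭-trans (prep q (insert-↭ p qs)) (↭.swap q p ↭-refl)

sort-↭ : ∀ ps → sort ps ↭ ps
sort-↭ [] = ↭-refl
sort-↭ (p ∷ ps) = ↭-trans (insert-↭ p (sort ps)) (prep p (sort-↭ ps))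

insert-sorted : ∀ p qs → AllPairs _<read_ qs → All (_≢ p) qs → AllPairs _<read_ (insert p qs)
insert-sorted p [] [] [] = [] ∷ []
insert-sorted p (q ∷ qs) (q<qs ∷ sorted) (q≢p ∷ qs≢p) with p <read? q
... | yes p<q = (p<q ∷ All.map (<read-trans p<q) q<qs) ∷ q<qs ∷ sorted
... | no p≮q = All-resp-↭ (↭-sym (insert-↭ p qs)) (q<p ∷ q<qs) ∷ insert-sorted p qs sorted qs≢p
  where
  q<p : q <read p
  q<p with compare p q
  ... | tri< p<q _ _ = ⊥-elim (p≮q p<q)
  ... | tri≈ _ p≈q _ = ⊥-elim (q≢p (sym (≡×≡⇒≡ p≈q)))
  ... | tri> _ _ q<p = q<p

readingWord-insert : ∀ p qs → AllPairs _<read_ qs → All (λ q → p <read q → Distant (letter p) (letter q)) qs →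
  readingWord (insert p qs) ∼ readingWord qs ∷ʳ letter p
readingWord-insert p [] [] [] = ∼-refl
readingWord-insert p (q ∷ qs) (q<qs ∷ sorted) (distant-q ∷ distant-qs) with p <read? q
... | yes p<q = begin
  letter p ∷ readingWord (q ∷ qs)        ≡⟨ cong (letter p ∷_) (++-identityʳ _) ⟨
  letter p ∷ readingWord (q ∷ qs) ++ []  ≈⟨ commute-past (readingWord (q ∷ qs)) [] all-distant ⟨
  readingWord (q ∷ qs) ∷ʳ letter p       ∎
  where
  open ∼-Reasoning
  all-distant : All (Distant (letter p)) (readingWord (q ∷ qs))
  all-distant = All.map⁺ {xs = q ∷ qs} (distant-q p<q ∷ distant-rest)
    where
    distant-rest : All (λ r → Distant (letter p) (letter r)) qs
    distant-rest = All.zipWith (λ (distant , q<r) → distant (<read-trans p<q q<r)) (distant-qs , q<qs)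
... | no _ = ∼-++ˡ [ letter q ] (readingWord-insert p qs sorted distant-qs)

ReadAfter : Point → Point → Set
ReadAfter p q = ¬ Distant (letter p) (letter q) → q <read p

sort-readingWord : ∀ ps → AllPairs ReadAfter ps →
  AllPairs _<read_ (sort ps) × readingWord (sort ps) ∼ reverse (readingWord ps)
sort-readingWord [] [] = [] , ∼-refl
sort-readingWord (p ∷ ps) (p-after ∷ after) =
  insert-sorted p (sort ps) sorted distinct , word
  where
  open ∼-Reasoning
  recursive : AllPairs _<read_ (sort ps) × readingWord (sort ps) ∼ reverse (readingWord ps)
  recursive = sort-readingWord ps after
  sorted : AllPairs _<read_ (sort ps)
  sorted = proj₁ recursive
  p-after′ : All (ReadAfter p) (sort ps)
  p-after′ = All-resp-↭ (↭-sym (sort-↭ ps)) p-after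
  distinct : All (_≢ p) (sort ps)
  distinct = All.map (λ { q-before refl → <read-irrefl (q-before Distant-irrefl) }) p-after′
  commuting : All (λ q → p <read q → Distant (letter p) (letter q)) (sort ps)
  commuting = All.map (λ {q} q-before p<q → distant-if-before q-before p<q) p-after′
    where
    distant-if-before : ∀ {q} → ReadAfter p q → p <read q → Distant (letter p) (letter q)
    distant-if-before {q} q-before p<q with distant? (letter p) (letter q)
    ... | yes distant = distant
    ... | no close = ⊥-elim (<read-asym p<q (q-before close))
  word : readingWord (insert p (sort ps)) ∼ reverse (readingWord (p ∷ ps))
  word = begin
    readingWord (insert p (sort ps))       ≈⟨ readingWord-insert p (sort ps) sorted commuting ⟩
    readingWord (sort ps) ∷ʳ letter p      ≈⟨ ∼-++ʳ [ letter p ] (proj₂ recursive) ⟩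
    reverse (readingWord ps) ∷ʳ letter p   ≡⟨ unfold-reverse (letter p) (readingWord ps) ⟨
    reverse (readingWord (p ∷ ps))         ∎

below-two : ∀ {c} → c < 2 → c ≡ 0 ⊎ c ≡ 1
below-two {0} _ = inj₁ refl
below-two {1} _ = inj₂ refl
below-two {suc (suc _)} (s≤s (s≤s ()))

no-three-below-two : ∀ {a b c} → a < 2 → b < 2 → c < 2 → a ≢ b → b ≢ c → a ≢ c → ⊥
no-three-below-two a<2 b<2 c<2 a≢b b≢c a≢c with below-two a<2 | below-two b<2 | below-two c<2
... | inj₁ refl | inj₁ refl | _ = a≢b refl
... | inj₂ refl | inj₂ refl | _ = a≢b refl
... | inj₁ refl | inj₂ refl | inj₁ refl = a≢c refl
... | inj₁ refl | inj₂ refl | inj₂ refl = b≢c refl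
... | inj₂ refl | inj₁ refl | inj₁ refl = b≢c refl
... | inj₂ refl | inj₁ refl | inj₂ refl = a≢c refl

reverse-split : ∀ {A : Set} {u : List A} T a S → reverse u ≡ T ++ a ∷ S → u ≡ reverse S ++ a ∷ reverse T
reverse-split {u = u} T a S eq = begin
  u                                 ≡⟨ reverse-involutive u ⟨
  reverse (reverse u)               ≡⟨ cong reverse eq ⟩
  reverse (T ++ a ∷ S)              ≡⟨ reverse-++ T (a ∷ S) ⟩
  reverse (a ∷ S) ++ reverse T      ≡⟨ cong (_++ reverse T) (unfold-reverse a S) ⟩
  (reverse S ++ [ a ]) ++ reverse T ≡⟨ ++-assoc (reverse S) [ a ] (reverse T) ⟩
  reverse S ++ a ∷ reverse T        ∎
  where open ≡-Reasoning

-- The configuration of a reduced word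

-- The c-th occurrence (from the left) of s_{m+1} in w becomes the point in column
-- column (m+1) + c of row m. Row m+1 starts one column right of row m exactly when
-- s_{m+1} occurs before s_{m+2}, and starts afresh at column 0 below an empty row.
module Construction (w : Word) (positive : All (1 ≤_) w) (alternating : ∀ k → Alternating k w) where

  column : ℕ → ℕ
  column zero = 0
  column (suc k) with occ k w
  ... | zero = 0
  ... | suc _ = column k + lead k w

  column-suc : ∀ {k} → 0 < occ k w → column (suc k) ≡ column k + lead k w
  column-suc {k} 0<occ with occ k w
  column-suc {k} () | zero
  ... | suc _ = refl

  balanced : ∀ k P Q → w ≡ P ++ Q → Balanced k (lead k w) P
  balanced k P Q refl = prefix-balanced k P Q (alternating k)

  balanced-w : ∀ k → Balanced k (lead k w) w
  balanced-w k = balanced k w [] (sym (++-identityʳ w))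

  present-positive : ∀ {k} → 0 < occ k w → 1 ≤ k
  present-positive {zero} 0<occ = ⊥-elim (<-irrefl (sym (occ-zero w positive)) 0<occ)
  present-positive {suc k} _ = s≤s z≤n

  present-after : ∀ P a Q → w ≡ P ++ a ∷ Q → 0 < occ a w
  present-after P a Q refl = <-≤-trans (subst (0 <_) (sym (occ-here a Q)) z<s) (occ-++-≤ʳ a P (a ∷ Q))

  column-bound : ∀ k c → c < occ k w → column k + c < k
  column-bound zero c c<occ = ⊥-elim (n≮0 (subst (c <_) (occ-zero w positive) c<occ))
  column-bound (suc k) c c<occ with occ k w in occ≡ | balanced-w k
  ... | zero | (_ , δ+occ≤1) = <-≤-trans (<-≤-trans c<occ (m≤n+m _ (lead k w))) (≤-trans δ+occ≤1 (s≤s z≤n))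
  ... | suc o | (_ , δ+occ≤2+o) = begin-strict
    column k + lead k w + c    ≡⟨ +-assoc (column k) (lead k w) c ⟩
    column k + (lead k w + c)  ≤⟨ +-monoʳ-≤ (column k) (≤-pred (<-≤-trans (+-monoʳ-< (lead k w) c<occ) δ+occ≤2+o)) ⟩
    column k + suc o           ≡⟨ +-suc (column k) o ⟩
    suc (column k + o)         ≤⟨ column-bound k o (subst (o <_) (sym occ≡) (n<1+n o)) ⟩
    k                          <⟨ n<1+n k ⟩
    suc k                      ∎
    where open ≤-Reasoning

  present-in-prefix : ∀ P R → w ≡ P ++ R → ∀ {b d} → d < occ b P → 0 < occ b w
  present-in-prefix P R refl {b} d<occ = ≤-<-trans z≤n (<-≤-trans d<occ (occ-++-≤ˡ b P R))

  upper-before-lower : ∀ P a Q → w ≡ P ++ a ∷ Q → ∀ {d} → d < occ (suc a) P →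
    column (suc a) + d ≤ column a + occ a P
  upper-before-lower P a Q w≡ {d} d<occ rewrite column-suc (present-after P a Q w≡) = begin
    column a + lead a w + d    ≡⟨ +-assoc (column a) (lead a w) d ⟩
    column a + (lead a w + d)  ≤⟨ +-monoʳ-≤ (column a) (≤-pred (<-≤-trans (+-monoʳ-< (lead a w) d<occ) δ+occ≤1+occ)) ⟩
    column a + occ a P         ∎
    where
    open ≤-Reasoning
    δ+occ≤1+occ = proj₂ (balanced a P (a ∷ Q) w≡)

  lower-before-upper : ∀ P R → w ≡ P ++ R → ∀ {b d} → d < occ b P →
    column b + d < column (suc b) + occ (suc b) P
  lower-before-upper P R w≡ {b} {d} d<occ rewrite column-suc (present-in-prefix P R w≡ d<occ) = begin-strict
    column b + d                          <⟨ +-monoʳ-< (column b) (<-≤-trans d<occ (proj₁ (balanced b P R w≡))) ⟩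
    column b + (lead b w + occ (suc b) P)  ≡⟨ +-assoc (column b) (lead b w) _ ⟨
    column b + lead b w + occ (suc b) P    ∎
    where open ≤-Reasoning

  site : ℕ → ℕ → Point
  site m c = spot m (column (suc m) + c)

  place : ℕ → ℕ → Point
  place a c = site (a ∸ 1) c

  letter-place : ∀ {a} c → 1 ≤ a → letter (place a c) ≡ a
  letter-place {suc m} c _ = letter-spot m (column (suc m) + c)

  earlier-left : ∀ P a Q → w ≡ P ++ a ∷ Q → ∀ b {d} → d < occ b P → ¬ Distant a b →
    xc (place b d) ℤ.< xc (place a (occ a P))
  earlier-left P a Q w≡ b d<occ close with b ≟ a | present-positive (present-after P a Q w≡)
  ... | yes refl | s≤s {n = m} z≤n = spot-left-same {m} (+-monoʳ-< (column a) d<occ)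
  ... | no b≢a | s≤s {n = m} z≤n with adjacent-if-not-distant b≢a close
  ...   | inj₁ refl = spot-left-down {m} (upper-before-lower P a Q w≡ d<occ)
  ...   | inj₂ refl with present-positive (present-in-prefix P (a ∷ Q) w≡ d<occ)
  ...     | s≤s {n = m′} z≤n = spot-left-up {m′} (lower-before-upper P (a ∷ Q) w≡ d<occ)

  read-after : ∀ P a Q → w ≡ P ++ a ∷ Q → ∀ {b d} → d < occ b P → ReadAfter (place a (occ a P)) (place b d)
  read-after P a Q w≡ {b} {d} d<occ
    rewrite letter-place (occ a P) (present-positive (present-after P a Q w≡))
          | letter-place d (present-positive (present-in-prefix P (a ∷ Q) w≡ d<occ))
    = inj₁ ∘ earlier-left P a Q w≡ b d<occ

  points : Word → List Point
  points [] = []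
  points (a ∷ u) = place a (occ a u) ∷ points u

  ∈-points : ∀ u {x} → x ∈ points u → ∃[ a ] ∃[ c ] (c < occ a u × x ≡ place a c)
  ∈-points (a ∷ u) (here refl) = a , occ a u , subst (occ a u <_) (sym (occ-here a u)) (n<1+n _) , refl
  ∈-points (a ∷ u) (there x∈) with ∈-points u x∈
  ... | b , c , c<occ , x≡ = b , c , <-≤-trans c<occ (occ-++-≤ʳ b [ a ] u) , x≡

  points-∈ : ∀ u {a c} → c < occ a u → place a c ∈ points u
  points-∈ (b ∷ u) {a} {c} c<occ with b ≟ a
  ... | no b≢a = there (points-∈ u (subst (c <_) (occ-there u b≢a) c<occ))
  ... | yes refl with m≤n⇒m<n∨m≡n (≤-pred (subst (c <_) (occ-here b u) c<occ))
  ...   | inj₁ c<occ′ = there (points-∈ u c<occ′)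
  ...   | inj₂ refl = here refl

  readingWord-points : ∀ u → All (1 ≤_) u → readingWord (points u) ≡ u
  readingWord-points [] [] = refl
  readingWord-points (a ∷ u) (1≤a ∷ pos) = cong₂ _∷_ (letter-place (occ a u) 1≤a) (readingWord-points u pos)

  points-ordered : ∀ T S → reverse w ≡ T ++ S → AllPairs ReadAfter (points S)
  points-ordered T [] _ = []
  points-ordered T (a ∷ S) eq =
    All.tabulate read-after-a ∷ points-ordered (T ++ [ a ]) S (trans eq (sym (++-assoc T [ a ] S)))
    where
    read-after-a : ∀ {q} → q ∈ points S → ReadAfter (place a (occ a S)) q
    read-after-a q∈ with ∈-points S q∈
    ... | b , d , d<occ , refl = subst (λ c → ReadAfter (place a c) (place b d)) (occ-reverse a S)
      (read-after (reverse S) a (reverse T) (reverse-split T a S eq) (subst (d <_) (sym (occ-reverse b S)) d<occ))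

  configuration : List Point
  configuration = sort (points (reverse w))

  configuration-sorted : AllPairs _<read_ configuration
  configuration-sorted = proj₁ (sort-readingWord (points (reverse w)) (points-ordered [] (reverse w) refl))

  readingWord-configuration : readingWord configuration ∼ w
  readingWord-configuration =
    subst (readingWord configuration ∼_) read-back
      (proj₂ (sort-readingWord (points (reverse w)) (points-ordered [] (reverse w) refl)))
    where
    read-back : reverse (readingWord (points (reverse w))) ≡ w
    read-back = trans (cong reverse (readingWord-points (reverse w) (All-resp-↭ (↭-sym (↭-reverse w)) positive)))
                      (reverse-involutive w)

  ∈-configuration : ∀ {x} → x ∈ configuration → ∃[ m ] ∃[ c ] (c < occ (suc m) w × x ≡ site m c)
  ∈-configuration x∈ with ∈-points (reverse w) (∈-resp-↭ (sort-↭ _) x∈)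
  ... | a , c , c<occ , refl with present-positive {a} (≤-<-trans z≤n (subst (c <_) (occ-reverse a w) c<occ))
  ... | s≤s {n = m} z≤n = m , c , subst (c <_) (occ-reverse (suc m) w) c<occ , refl

  site-∈ : ∀ {m c} → c < occ (suc m) w → site m c ∈ configuration
  site-∈ {m} {c} c<occ =
    ∈-resp-↭ (↭-sym (sort-↭ _)) (points-∈ (reverse w) (subst (c <_) (sym (occ-reverse (suc m) w)) c<occ))

  isConfiguration : IsConfiguration configuration
  isConfiguration = All.tabulate in-triangle , AllPairs⇒Linked configuration-sorted
    where
    in-triangle : ∀ {x} → x ∈ configuration → InT x
    in-triangle x∈ with ∈-configuration x∈
    ... | m , c , c<occ , refl = spot-inT (≤-pred (column-bound (suc m) c c<occ))

  double⇒lead<occ : ∀ k → occ (suc k) w ≡ 2 → lead k w < occ k w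
  double⇒lead<occ k occ≡2 =
    ≤-pred (subst (_≤ suc (occ k w)) (trans (cong (λ o → lead k w + o) occ≡2) (+-comm (lead k w) 2))
                  (proj₂ (balanced-w k)))

  double⇒2≤lead+occ : ∀ k → occ k w ≡ 2 → 2 ≤ lead k w + occ (suc k) w
  double⇒2≤lead+occ k occ≡2 = subst (_≤ lead k w + occ (suc k) w) occ≡2 (proj₁ (balanced-w k))

  above-site : ∀ m → occ (suc m) w ≡ 2 →
    ∃[ m′ ] (m ≡ suc m′ × ∃[ e ] (e < occ (suc m′) w × site m′ e ≡ spot m′ (column (suc m) + 0)))
  above-site m occ≡2 with present-positive {m} (≤-<-trans z≤n (double⇒lead<occ m occ≡2))
  ... | s≤s {n = m′} z≤n = m′ , refl , lead (suc m′) w , double⇒lead<occ (suc m′) occ≡2 ,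
    cong (spot m′) (sym (trans (+-identityʳ _) (column-suc (≤-<-trans z≤n (double⇒lead<occ (suc m′) occ≡2)))))

  below-site : ∀ m → occ (suc m) w ≡ 2 →
    ∃[ e ] (e < occ (suc (suc m)) w × site (suc m) e ≡ spot (suc m) (suc (column (suc m) + 0)))
  below-site m occ≡2 = 1 ∸ δ , 1∸δ<occ , cong (spot (suc m)) (begin
    column (suc (suc m)) + (1 ∸ δ)     ≡⟨ cong (_+ (1 ∸ δ)) (column-suc (subst (0 <_) (sym occ≡2) z<s)) ⟩
    column (suc m) + δ + (1 ∸ δ)       ≡⟨ +-assoc (column (suc m)) δ (1 ∸ δ) ⟩
    column (suc m) + (δ + (1 ∸ δ))     ≡⟨ cong (λ x → column (suc m) + x) δ+[1∸δ]≡1 ⟩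
    column (suc m) + 1                 ≡⟨ +-suc (column (suc m)) 0 ⟩
    suc (column (suc m) + 0)           ∎)
    where
    open ≡-Reasoning
    δ : ℕ
    δ = lead (suc m) w
    δ+[1∸δ]≡1 : δ + (1 ∸ δ) ≡ 1
    δ+[1∸δ]≡1 = m+[n∸m]≡n (lead≤1 (suc m) w)
    1∸δ<occ : 1 ∸ δ < occ (suc (suc m)) w
    1∸δ<occ = +-cancelˡ-< δ (1 ∸ δ) _
      (subst (_< δ + occ (suc (suc m)) w) (sym δ+[1∸δ]≡1) (double⇒2≤lead+occ (suc m) occ≡2))

  site-gap : ∀ m → ∣ xc (site m 0) ℤ.- xc (site m 1) ∣ ≡ 2
  site-gap m = subst (λ t → ∣ xc (site m 0) ℤ.- xc (spot m t) ∣ ≡ 2) (sym (+-suc (column (suc m)) 0))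
                 (spot-gap m (column (suc m) + 0))

  site-left : ∀ m → xc (site m 0) ℤ.< xc (site m 1)
  site-left m = spot-left-same {m} (+-monoʳ-< (column (suc m)) z<s)

  module _ (two-repeating : ∀ i → occ i w ≤ 2) where

    at-most-two : ∀ {m c} → c < occ (suc m) w → c < 2
    at-most-two c<occ = <-≤-trans c<occ (two-repeating _)

    no-three-in-a-row : ∀ p q r → p ∈ configuration → q ∈ configuration → r ∈ configuration →
      p ≢ q → q ≢ r → p ≢ r → yc p ≡ yc q → yc q ≡ yc r → ⊥
    no-three-in-a-row p q r p∈ q∈ r∈ p≢q q≢r p≢r yp≡yq yq≡yr
      with ∈-configuration p∈ | ∈-configuration q∈ | ∈-configuration r∈
    ... | m , c₁ , c₁<occ , refl | _ , c₂ , c₂<occ , refl | _ , c₃ , c₃<occ , refl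
      with row-injective yp≡yq | row-injective yq≡yr
    ... | refl | refl = no-three-below-two (at-most-two c₁<occ) (at-most-two c₂<occ) (at-most-two c₃<occ)
                          (p≢q ∘ cong (site m)) (q≢r ∘ cong (site m)) (p≢r ∘ cong (site m))

    row-gap : ∀ p q → p ∈ configuration → q ∈ configuration → p ≢ q → yc p ≡ yc q →
      ∣ xc p ℤ.- xc q ∣ ≡ 2
    row-gap p q p∈ q∈ p≢q yp≡yq with ∈-configuration p∈ | ∈-configuration q∈
    ... | m , c₁ , c₁<occ , refl | _ , c₂ , c₂<occ , refl with row-injective yp≡yq
    ... | refl with below-two (at-most-two c₁<occ) | below-two (at-most-two c₂<occ)
    ...   | inj₁ refl | inj₁ refl = ⊥-elim (p≢q refl)
    ...   | inj₂ refl | inj₂ refl = ⊥-elim (p≢q refl)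
    ...   | inj₁ refl | inj₂ refl = site-gap m
    ...   | inj₂ refl | inj₁ refl = trans (ℤP.∣i-j∣≡∣j-i∣ (xc (site m 1)) _) (site-gap m)

    row-neighbours : ∀ p q → p ∈ configuration → q ∈ configuration → yc p ≡ yc q → xc p ℤ.< xc q →
      ((xc p ℤ.+ + 1 , yc p ℤ.+ + 1) ∈ configuration) × ((xc p ℤ.+ + 1 , yc p ℤ.- + 1) ∈ configuration)
    row-neighbours p q p∈ q∈ yp≡yq xp<xq with ∈-configuration p∈ | ∈-configuration q∈
    ... | m , c₁ , c₁<occ , refl | _ , c₂ , c₂<occ , refl with row-injective yp≡yq
    ... | refl with below-two (at-most-two c₁<occ) | below-two (at-most-two c₂<occ)
    ...   | inj₁ refl | inj₁ refl = ⊥-elim (ℤP.<-irrefl refl xp<xq)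
    ...   | inj₂ refl | inj₂ refl = ⊥-elim (ℤP.<-irrefl refl xp<xq)
    ...   | inj₂ refl | inj₁ refl = ⊥-elim (ℤP.<-asym xp<xq (site-left m))
    ...   | inj₁ refl | inj₂ refl = above , below
      where
      occ≡2 : occ (suc m) w ≡ 2
      occ≡2 = ≤-antisym (two-repeating (suc m)) c₂<occ
      above : (xc (site m 0) ℤ.+ + 1 , yc (site m 0) ℤ.+ + 1) ∈ configuration
      above with above-site m occ≡2
      ... | m′ , refl , e , e<occ , site≡ =
        subst (_∈ configuration) (trans site≡ (sym (spot-up m′ (column (suc (suc m′)) + 0)))) (site-∈ e<occ)
      below : (xc (site m 0) ℤ.+ + 1 , yc (site m 0) ℤ.- + 1) ∈ configuration
      below with below-site m occ≡2
      ... | e , e<occ , site≡ =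
        subst (_∈ configuration) (trans site≡ (sym (spot-down m (column (suc m) + 0)))) (site-∈ e<occ)

    admissible : Admissible configuration
    admissible = no-three-in-a-row , row-gap , row-neighbours

lemma4p4 : (n : ℕ) (v : Permutation′ n) → Avoids321 n v → TwoRepeating n v →
    ∃[ C ] (IsConfiguration C × Admissible C × ReducedExpr n v (readingWord C))
lemma4p4 n v avoids two-repeating with reduced-expression v
... | w , red = configuration , isConfiguration , admissible (two-repeating w red) ,
                ReducedExpr-resp-∼ {n} {v} (∼-sym readingWord-configuration) red
  where open Construction w (All.map proj₁ (proj₁ red)) (reduced-alternating {n} {v} avoids red)
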